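{- Let $G=(V,E)$ be a loop-free multigraph with $n=|V|$. Consider the deterministic algorithm which, for $i=1,\dots,n$, having already fixed distinct vertices $v_1,\dots,v_{i-1}$, chooses $v_i\in V\setminus\{v_1,\dots,v_{i-1}\}$ maximizing $\mathbb{E}_{v_1,\dots,v_{i-1},v_i}$, and outputs the order $(v_1,\dots,v_n)$. The output order $\sigma$ satisfies $\sum_{v\in V}\overleftarrow{d}_\sigma(v)\overrightarrow{d}_\sigma(v)\ge\frac13\max_{\tau}\sum_{v\in V}\overleftarrow{d}_\tau(v)\overrightarrow{d}_\tau(v)$, the maximum being over all vertex orders $\tau$ of $G$.
   Context: A vertex order is a linear ordering $\sigma=(\sigma_1,\dots,\sigma_n)$ of $V$; for $v=\sigma_i$, the left-degree $\overleftarrow{d}_\sigma(v)$ is the number of edges (with multiplicity) joining $v$ to $\{\sigma_1,\dots,\sigma_{i-1}\}$ and the right-degree $\overrightarrow{d}_\sigma(v)$ is the number of edges joining $v$ to $\{\sigma_{i+1},\dots,\sigma_n\}$. For distinct vertices $v_1,\dots,v_i$, $\mathbb{E}_{v_1,\dots,v_i}$ denotes the average of $\sum_{v\in V}\overleftarrow{d}_\sigma(v)\overrightarrow{d}_\sigma(v)$ over all $(n-i)!$ vertex orders $\sigma$ with $\sigma_j=v_j$ for all $j\le i$. -}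

module Defs where

open import Data.Nat using (ℕ; zero; suc; _+_; _*_)
open import Data.Fin using (Fin)
open import Data.Fin.Properties using (_≟_)
open import Data.Nat.ListAction using (sum)
open import Data.List using (List; []; _∷_; map; length; concatMap; filter; allFin; _++_; [_])
open import Data.Integer using (+_)
open import Data.Rational using (ℚ; 0ℚ; _/_)
open import Relation.Binary.PropositionalEquality using (_≡_)
open import Relation.Nullary using (¬_)
open import Relation.Nullary.Decidable using (¬?)
import Data.List.Membership.DecPropositional as DecMem

-- A loop-free multigraph on the vertex set Fin n, given by its edge
-- multiplicity function: mult u v = number of edges joining u and v.
record Multigraph (n : ℕ) : Set where
  field
    mult     : Fin n → Fin n → ℕ
    symm     : ∀ u v → mult u v ≡ mult v u
    loopFree : ∀ v → mult v v ≡ 0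
open Multigraph public

edgesTo : ∀ {n} → Multigraph n → Fin n → List (Fin n) → ℕ
edgesTo G v S = sum (map (mult G v) S)

-- Σ_v leftdeg(v) * rightdeg(v) for a vertex order given as a list;
-- `pre` is the list of vertices already placed (to the left).
scoreFrom : ∀ {n} → Multigraph n → List (Fin n) → List (Fin n) → ℕ
scoreFrom G pre [] = 0
scoreFrom G pre (v ∷ rest) = edgesTo G v pre * edgesTo G v rest + scoreFrom G (v ∷ pre) rest

score : ∀ {n} → Multigraph n → List (Fin n) → ℕ
score G σ = scoreFrom G [] σ

insertions : {A : Set} → A → List A → List (List A)
insertions x [] = (x ∷ []) ∷ []
insertions x (y ∷ ys) = (x ∷ y ∷ ys) ∷ map (y ∷_) (insertions x ys)

perms : {A : Set} → List A → List (List A)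
perms [] = [] ∷ []
perms (x ∷ xs) = concatMap (insertions x) (perms xs)

open import Data.List.Relation.Binary.Permutation.Propositional using (_↭_)
IsOrder : ∀ {n} → List (Fin n) → Set
IsOrder {n} σ = σ ↭ allFin n

remaining : ∀ {n} → List (Fin n) → List (Fin n)
remaining {n} pre = filter (λ u → ¬? (u ∈? pre)) (allFin n)
  where open DecMem (_≟_ {n})

-- arithmetic mean of a list of naturals (0 for the empty list, never used)
average : List ℕ → ℚ
average [] = 0ℚ
average (x ∷ xs) = (+ sum (x ∷ xs)) / length (x ∷ xs)

𝔼 : ∀ {n} → Multigraph n → List (Fin n) → ℚ
𝔼 G pre = average (map (λ τ → score G (pre ++ τ)) (perms (remaining pre)))

IsGreedyOutput : ∀ {n} → Multigraph n → List (Fin n) → Set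
IsGreedyOutput {n} G σ =
  IsOrder σ ×' (∀ (pre : List (Fin n)) (v : Fin n) (suf : List (Fin n)) →
    σ ≡ pre ++ v ∷ suf →
    ∀ (u : Fin n) → ¬ (u ∈ pre) → 𝔼 G (pre ++ [ u ]) Data.Rational.≤ 𝔼 G (pre ++ [ v ]))
  where
    open import Data.Product using () renaming (_×_ to _×'_)
    open import Data.List.Membership.Propositional using (_∈_)

{-# OPTIONS --safe #-}
-- For a prefix A and remaining vertices R, six times the average of the score over the orders of R
-- is sixMean A R = Σ_{u ∈ R} (3·e(u,A)·e(u,R) + P(u,R)), where P(u,R) = edgePairs u R counts
-- ordered pairs of edges from u to two different vertices of R.  For any order τ, 2·left(u)·right(u) ≤ P(u,V), since each pair
-- of a left and a right edge of u is such a pair; hence score τ ≤ 3·𝔼_∅.  The completions of a prefix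
-- split into equally many completions of each one-vertex extension, so 𝔼 of a prefix is the average
-- of 𝔼 over its extensions and a maximizing greedy choice never decreases 𝔼.  Thus
-- score σ = 𝔼_σ ≥ 𝔼_∅ ≥ score τ / 3.
module Submission where

open import Defs
open import Data.Nat using (ℕ; zero; suc; _+_; _*_; _≤_; _!; z≤n; NonZero)
open import Data.Nat.Properties hiding (_≟_)
open import Data.Nat.ListAction using (sum)
open import Data.Nat.ListAction.Properties using (sum-++; sum-↭)
open import Data.Nat.Solver using (module +-*-Solver)
open import Data.Product using (_×_; _,_; proj₁; proj₂)
open import Data.List using (List; []; _∷_; map; length; concatMap; filter; allFin; _++_; [_])
open import Data.List.Properties
  using (map-++; length-++; length-map; ++-assoc; ++-identityʳ; filter-accept; filter-reject; filter-all; filter-none; filter-≐)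
open import Data.List.Relation.Unary.All as All using (All)
open import Data.List.Relation.Unary.Any using (here; there)
open import Data.List.Relation.Unary.AllPairs using (_∷_)
open import Data.List.Relation.Unary.Unique.Propositional using (Unique)
import Data.List.Relation.Unary.Unique.Propositional.Properties as Unique
open import Data.List.Membership.Propositional using (_∈_; _∉_)
open import Data.List.Membership.Propositional.Properties
  using (∈-map⁻; ∈-concat⁻′; ∈-filter⁻; ∈-filter⁺; ∈-allFin; ∈-++⁺ˡ; ∈-++⁺ʳ; ∈-++⁻)
open import Data.List.Relation.Binary.Permutation.Propositional
  using (_↭_; ↭-refl; ↭-sym; ↭-trans; prep; swap; ↭⇒↭ₛ)
open import Data.List.Relation.Binary.Permutation.Propositional.Properties using (map⁺; ↭-length; ∈-resp-↭)
import Data.List.Relation.Binary.Permutation.Setoid.Properties as ↭ₛ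
open import Relation.Binary.PropositionalEquality hiding ([_])
open import Relation.Binary.Definitions using (DecidableEquality)
open import Relation.Unary using (Pred; Decidable; _≐_)
open import Data.Sum using ([_,_]′)
import Data.List.Membership.DecPropositional as DecMem
open import Level using (0ℓ)
open import Data.Fin using (Fin)
open import Data.Fin.Properties using (_≟_)
open import Relation.Nullary using (yes; no)
open import Relation.Nullary.Decidable using (¬?; _×-dec_)
open import Algebra.Properties.CommutativeSemigroup +-commutativeSemigroup using () renaming (interchange to +-interchange)
open import Function using (_∘_)
import Data.Integer as ℤ
import Data.Integer.Properties as ℤ
open import Data.Rational using (_/_; fromℚᵘ) renaming (_≤_ to _≤ℚ_)
import Data.Rational.Properties as ℚ
open import Data.Rational.Unnormalised using (mkℚᵘ; *≤*)
import Data.Rational.Unnormalised.Properties as ℚᵘ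
open import Function.Bundles using (_⇔_; mk⇔; Equivalence)
open +-*-Solver

∑ : {A : Set} → (A → ℕ) → List A → ℕ
∑ f xs = sum (map f xs)

module _ {A : Set} where

  ∑-++ : ∀ (f : A → ℕ) xs ys → ∑ f (xs ++ ys) ≡ ∑ f xs + ∑ f ys
  ∑-++ f xs ys = trans (cong sum (map-++ f xs ys)) (sum-++ (map f xs) (map f ys))

  ∑-distrib-+ : ∀ (f g : A → ℕ) xs → ∑ (λ x → f x + g x) xs ≡ ∑ f xs + ∑ g xs
  ∑-distrib-+ f g [] = refl
  ∑-distrib-+ f g (x ∷ xs) rewrite ∑-distrib-+ f g xs = +-interchange (f x) (g x) (∑ f xs) (∑ g xs)

  ∑-*ˡ : ∀ c (f : A → ℕ) xs → ∑ (λ x → c * f x) xs ≡ c * ∑ f xs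
  ∑-*ˡ c f [] = sym (*-zeroʳ c)
  ∑-*ˡ c f (x ∷ xs) rewrite ∑-*ˡ c f xs = sym (*-distribˡ-+ c (f x) (∑ f xs))

  ∑-const : ∀ c (xs : List A) → ∑ (λ _ → c) xs ≡ length xs * c
  ∑-const c [] = refl
  ∑-const c (x ∷ xs) = cong (c +_) (∑-const c xs)

  ∑-cong : ∀ {f g : A → ℕ} xs → (∀ {x} → x ∈ xs → f x ≡ g x) → ∑ f xs ≡ ∑ g xs
  ∑-cong [] eq = refl
  ∑-cong (x ∷ xs) eq = cong₂ _+_ (eq (here refl)) (∑-cong xs (eq ∘ there))

  ∑-mono-≤ : ∀ {f g : A → ℕ} xs → (∀ {x} → x ∈ xs → f x ≤ g x) → ∑ f xs ≤ ∑ g xs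
  ∑-mono-≤ [] le = z≤n
  ∑-mono-≤ (x ∷ xs) le = +-mono-≤ (le (here refl)) (∑-mono-≤ xs (λ x∈ → le (there x∈)))

  ∑-↭ : ∀ (f : A → ℕ) {xs ys} → xs ↭ ys → ∑ f xs ≡ ∑ f ys
  ∑-↭ f p = sum-↭ (map⁺ f p)

  ∑-comm : ∀ (H : A → A → ℕ) xs ys → ∑ (λ x → ∑ (H x) ys) xs ≡ ∑ (λ y → ∑ (λ x → H x y) xs) ys
  ∑-comm H [] ys = sym (trans (∑-const 0 ys) (*-zeroʳ (length ys)))
  ∑-comm H (x ∷ xs) ys rewrite ∑-comm H xs ys = sym (∑-distrib-+ (H x) (λ y → ∑ (λ x → H x y) xs) ys)

module _ {A B : Set} where

  ∑-map : ∀ (f : B → ℕ) (g : A → B) xs → ∑ f (map g xs) ≡ ∑ (λ x → f (g x)) xs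
  ∑-map f g [] = refl
  ∑-map f g (x ∷ xs) = cong (f (g x) +_) (∑-map f g xs)

  ∑-concatMap : ∀ (f : B → ℕ) (g : A → List B) xs → ∑ f (concatMap g xs) ≡ ∑ (λ x → ∑ f (g x)) xs
  ∑-concatMap f g [] = refl
  ∑-concatMap f g (x ∷ xs) = trans (∑-++ f (g x) (concatMap g xs)) (cong (∑ f (g x) +_) (∑-concatMap f g xs))

  length-concatMap : ∀ (g : A → List B) xs → length (concatMap g xs) ≡ ∑ (λ x → length (g x)) xs
  length-concatMap g [] = refl
  length-concatMap g (x ∷ xs) = trans (length-++ (g x)) (cong (length (g x) +_) (length-concatMap g xs))

module _ {A : Set} {P Q : Pred A 0ℓ} (P? : Decidable P) (Q? : Decidable Q) where

  filter-filter : ∀ xs → filter P? (filter Q? xs) ≡ filter (λ x → Q? x ×-dec P? x) xs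
  filter-filter [] = refl
  filter-filter (x ∷ xs) with Q? x
  ... | no _ = filter-filter xs
  ... | yes _ with P? x
  ...   | yes _ = cong (x ∷_) (filter-filter xs)
  ...   | no _ = filter-filter xs

module _ {A : Set} where

  Unique-resp-↭ : ∀ {xs ys : List A} → xs ↭ ys → Unique xs → Unique ys
  Unique-resp-↭ p = ↭ₛ.Unique-resp-↭ (setoid A) (↭⇒↭ₛ p)

  Unique-++-∷⇒∉ : ∀ (xs : List A) {v ys} → Unique (xs ++ v ∷ ys) → v ∉ xs
  Unique-++-∷⇒∉ (x ∷ xs) (x∉ ∷ _) (here refl) = All.lookup x∉ (∈-++⁺ʳ xs (here refl)) refl
  Unique-++-∷⇒∉ (x ∷ xs) (_ ∷ uq) (there v∈) = Unique-++-∷⇒∉ xs uq v∈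

  insertions-↭ : ∀ (x : A) π {ρ} → ρ ∈ insertions x π → ρ ↭ x ∷ π
  insertions-↭ x [] (here refl) = ↭-refl
  insertions-↭ x (y ∷ ys) (here refl) = ↭-refl
  insertions-↭ x (y ∷ ys) (there ρ∈) with ∈-map⁻ (y ∷_) ρ∈
  ... | ρ′ , ρ′∈ , refl = ↭-trans (prep y (insertions-↭ x ys ρ′∈)) (swap y x ↭-refl)

  perms-↭ : ∀ (xs : List A) {π} → π ∈ perms xs → π ↭ xs
  perms-↭ [] (here refl) = ↭-refl
  perms-↭ (x ∷ xs) π∈ with ∈-concat⁻′ (map (insertions x) (perms xs)) π∈
  ... | ρs , π∈ρs , ρs∈ with ∈-map⁻ (insertions x) ρs∈
  ...   | ρ , ρ∈ , refl = ↭-trans (insertions-↭ x ρ π∈ρs) (prep x (perms-↭ xs ρ∈))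

  length-insertions : ∀ (x : A) π → length (insertions x π) ≡ suc (length π)
  length-insertions x [] = refl
  length-insertions x (y ∷ ys) = cong suc (trans (length-map (y ∷_) (insertions x ys)) (length-insertions x ys))

  length-perms : ∀ (xs : List A) → length (perms xs) ≡ length xs !
  length-perms [] = refl
  length-perms (x ∷ xs) = begin
    length (concatMap (insertions x) (perms xs))
      ≡⟨ length-concatMap (insertions x) (perms xs) ⟩
    ∑ (λ π → length (insertions x π)) (perms xs)
      ≡⟨ ∑-cong (perms xs) (λ {π} π∈ → trans (length-insertions x π) (cong suc (↭-length (perms-↭ xs π∈)))) ⟩
    ∑ (λ _ → suc (length xs)) (perms xs)
      ≡⟨ ∑-const (suc (length xs)) (perms xs) ⟩
    length (perms xs) * suc (length xs)
      ≡⟨ cong (_* suc (length xs)) (length-perms xs) ⟩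
    length xs ! * suc (length xs)
      ≡⟨ *-comm (length xs !) (suc (length xs)) ⟩
    suc (length xs) ! ∎
    where open ≡-Reasoning

module Removal {A : Set} (_≟_ : DecidableEquality A) where

  remove : A → List A → List A
  remove u = filter (λ w → ¬? (w ≟ u))

  remove-∷-self : ∀ u xs → remove u (u ∷ xs) ≡ remove u xs
  remove-∷-self u xs = filter-reject (λ w → ¬? (w ≟ u)) (λ u≢u → u≢u refl)

  remove-∷ : ∀ {a u} xs → a ≢ u → remove u (a ∷ xs) ≡ a ∷ remove u xs
  remove-∷ {u = u} xs = filter-accept (λ w → ¬? (w ≟ u))

  remove-∉ : ∀ {u} xs → u ∉ xs → remove u xs ≡ xs
  remove-∉ {u} xs u∉ = filter-all (λ w → ¬? (w ≟ u)) (All.tabulate (λ { w∈ refl → u∉ w∈ }))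

  ∈-remove⁻ : ∀ {u w} xs → w ∈ remove u xs → w ∈ xs
  ∈-remove⁻ {u} xs w∈ = proj₁ (∈-filter⁻ (λ w → ¬? (w ≟ u)) {xs = xs} w∈)

  Unique-remove : ∀ u {xs} → Unique xs → Unique (remove u xs)
  Unique-remove u = Unique.filter⁺ (λ w → ¬? (w ≟ u))

  ∑-remove : ∀ (f : A → ℕ) {u} xs → u ∈ xs → Unique xs → ∑ f (remove u xs) + f u ≡ ∑ f xs
  ∑-remove f {u} (u ∷ xs) (here refl) uq
    rewrite remove-∷-self u xs | remove-∉ xs (Unique.Unique[x∷xs]⇒x∉xs uq) = +-comm (∑ f xs) (f u)
  ∑-remove f {u} (a ∷ xs) (there u∈) (a∉ ∷ uq) rewrite remove-∷ xs (All.lookup a∉ u∈) =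
    trans (+-assoc (f a) _ (f u)) (cong (f a +_) (∑-remove f xs u∈ uq))

  length-remove : ∀ {u} xs → u ∈ xs → Unique xs → length xs ≡ suc (length (remove u xs))
  length-remove {u} (u ∷ xs) (here refl) uq
    rewrite remove-∷-self u xs | remove-∉ xs (Unique.Unique[x∷xs]⇒x∉xs uq) = refl
  length-remove {u} (a ∷ xs) (there u∈) (a∉ ∷ uq)
    rewrite remove-∷ xs (All.lookup a∉ u∈) = cong suc (length-remove xs u∈ uq)

  ∑-remove-comm : ∀ (H : A → A → ℕ) xs → Unique xs →
    ∑ (λ u → ∑ (H u) (remove u xs)) xs ≡ ∑ (λ w → ∑ (λ u → H u w) (remove w xs)) xs
  ∑-remove-comm H xs uq = +-cancelʳ-≡ _ _ _ (begin
    ∑ (λ u → ∑ (H u) (remove u xs)) xs + ∑ (λ u → H u u) xs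
      ≡⟨ ∑-distrib-+ _ _ xs ⟨
    ∑ (λ u → ∑ (H u) (remove u xs) + H u u) xs
      ≡⟨ ∑-cong xs (λ u∈ → ∑-remove (H _) xs u∈ uq) ⟩
    ∑ (λ u → ∑ (H u) xs) xs
      ≡⟨ ∑-comm H xs xs ⟩
    ∑ (λ w → ∑ (λ u → H u w) xs) xs
      ≡⟨ ∑-cong xs (λ w∈ → ∑-remove (λ u → H u _) xs w∈ uq) ⟨
    ∑ (λ w → ∑ (λ u → H u w) (remove w xs) + H w w) xs
      ≡⟨ ∑-distrib-+ _ _ xs ⟩
    ∑ (λ w → ∑ (λ u → H u w) (remove w xs)) xs + ∑ (λ u → H u u) xs ∎)
    where open ≡-Reasoning

  ∑-perms-by-head : ∀ {v} xs → v ∈ xs → Unique xs → (f : List A → ℕ) →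
    ∑ f (perms xs) ≡ ∑ (λ u → ∑ (f ∘ (u ∷_)) (perms (remove u xs))) xs
  ∑-perms-by-head₀ : ∀ xs → Unique xs → (f : List A → ℕ) → f [] ≡ 0 →
    ∑ f (perms xs) ≡ ∑ (λ u → ∑ (f ∘ (u ∷_)) (perms (remove u xs))) xs

  ∑-perms-by-head₀ [] _ f f[]≡0 = cong (_+ 0) f[]≡0
  ∑-perms-by-head₀ xs@(_ ∷ _) uq f _ = ∑-perms-by-head xs (here refl) uq f

  ∑-perms-by-head (x ∷ xs) _ uq@(x∉ ∷ uq′) f = begin
    ∑ f (concatMap (insertions x) (perms xs))
      ≡⟨ ∑-concatMap f (insertions x) (perms xs) ⟩
    ∑ (λ π → ∑ f (insertions x π)) (perms xs)
      ≡⟨ ∑-cong (perms xs) (λ {π} _ → ∑-insertions π) ⟩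
    ∑ (λ π → f (x ∷ π) + tailSum π) (perms xs)
      ≡⟨ ∑-distrib-+ (f ∘ (x ∷_)) tailSum (perms xs) ⟩
    ∑ (f ∘ (x ∷_)) (perms xs) + ∑ tailSum (perms xs)
      ≡⟨ cong₂ _+_ (cong (∑ (f ∘ (x ∷_)) ∘ perms) (sym remove-head))
                   (∑-perms-by-head₀ xs uq′ tailSum refl) ⟩
    ∑ (f ∘ (x ∷_)) (perms (remove x (x ∷ xs))) + ∑ (λ y → ∑ (tailSum ∘ (y ∷_)) (perms (remove y xs))) xs
      ≡⟨ cong (∑ (f ∘ (x ∷_)) (perms (remove x (x ∷ xs))) +_) (∑-cong xs later-head) ⟩
    ∑ (f ∘ (x ∷_)) (perms (remove x (x ∷ xs)))
      + ∑ (λ y → ∑ (f ∘ (y ∷_)) (perms (remove y (x ∷ xs)))) xs ∎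
    where
    open ≡-Reasoning
    -- inserting x anywhere but in front of y ∷ π keeps the head y
    tailSum : List A → ℕ
    tailSum [] = 0
    tailSum (y ∷ π) = ∑ (f ∘ (y ∷_)) (insertions x π)

    ∑-insertions : ∀ π → ∑ f (insertions x π) ≡ f (x ∷ π) + tailSum π
    ∑-insertions [] = refl
    ∑-insertions (y ∷ π) = cong (f (x ∷ y ∷ π) +_) (∑-map f (y ∷_) (insertions x π))

    remove-head : remove x (x ∷ xs) ≡ xs
    remove-head = trans (remove-∷-self x xs) (remove-∉ xs (Unique.Unique[x∷xs]⇒x∉xs uq))

    later-head : ∀ {y} → y ∈ xs →
      ∑ (tailSum ∘ (y ∷_)) (perms (remove y xs)) ≡ ∑ (f ∘ (y ∷_)) (perms (remove y (x ∷ xs)))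
    later-head {y} y∈ = begin
      ∑ (tailSum ∘ (y ∷_)) (perms (remove y xs))
        ≡⟨ ∑-concatMap (f ∘ (y ∷_)) (insertions x) (perms (remove y xs)) ⟨
      ∑ (f ∘ (y ∷_)) (perms (x ∷ remove y xs))
        ≡⟨ cong (∑ (f ∘ (y ∷_)) ∘ perms) (remove-∷ xs (All.lookup x∉ y∈)) ⟨
      ∑ (f ∘ (y ∷_)) (perms (remove y (x ∷ xs))) ∎

module MeanScore {n : ℕ} (G : Multigraph n) where
  open Removal (_≟_ {n})

  private
    m : Fin n → Fin n → ℕ
    m = mult G
    e : Fin n → List (Fin n) → ℕ
    e = edgesTo G

  edgesTo-remove-self : ∀ {u} R → u ∈ R → Unique R → e u (remove u R) ≡ e u R
  edgesTo-remove-self {u} R u∈ uq = begin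
    e u (remove u R)          ≡⟨ +-identityʳ _ ⟨
    e u (remove u R) + 0      ≡⟨ cong (e u (remove u R) +_) (loopFree G u) ⟨
    e u (remove u R) + m u u  ≡⟨ ∑-remove (m u) R u∈ uq ⟩
    e u R                     ∎
    where open ≡-Reasoning

  edgePairs : Fin n → List (Fin n) → ℕ
  edgePairs u [] = 0
  edgePairs u (a ∷ R) = 2 * (m u a * e u R) + edgePairs u R

  edgePairs+squares : ∀ u R → edgePairs u R + ∑ (λ a → m u a * m u a) R ≡ e u R * e u R
  edgePairs+squares u [] = refl
  edgePairs+squares u (a ∷ R) = begin
    2 * (x * E) + edgePairs u R + (x * x + squares)
      ≡⟨ solve 4 (λ x E p s → con 2 :* (x :* E) :+ p :+ (x :* x :+ s) := con 2 :* (x :* E) :+ x :* x :+ (p :+ s))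
           refl x E (edgePairs u R) squares ⟩
    2 * (x * E) + x * x + (edgePairs u R + squares)
      ≡⟨ cong (2 * (x * E) + x * x +_) (edgePairs+squares u R) ⟩
    2 * (x * E) + x * x + E * E
      ≡⟨ solve 2 (λ x E → con 2 :* (x :* E) :+ x :* x :+ E :* E := (x :+ E) :* (x :+ E)) refl x E ⟩
    (x + E) * (x + E) ∎
    where
    open ≡-Reasoning
    x = m u a
    E = e u R
    squares = ∑ (λ a → m u a * m u a) R

  edgePairs-↭ : ∀ u {R R′} → R ↭ R′ → edgePairs u R ≡ edgePairs u R′
  edgePairs-↭ u {R} {R′} p = +-cancelʳ-≡ _ _ _ (begin
    edgePairs u R + ∑ square R                    ≡⟨ edgePairs+squares u R ⟩
    e u R * e u R                                 ≡⟨ cong₂ _*_ (∑-↭ (m u) p) (∑-↭ (m u) p) ⟩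
    e u R′ * e u R′                               ≡⟨ edgePairs+squares u R′ ⟨
    edgePairs u R′ + ∑ square R′                  ≡⟨ cong (edgePairs u R′ +_) (∑-↭ square p) ⟨
    edgePairs u R′ + ∑ square R                   ∎)
    where
    open ≡-Reasoning
    square : Fin n → ℕ
    square a = m u a * m u a

  edgePairs-remove : ∀ {u} w R → u ∈ R → Unique R →
    edgePairs w R ≡ 2 * (m w u * e w (remove u R)) + edgePairs w (remove u R)
  edgePairs-remove {u} w (u ∷ R) (here refl) uq
    rewrite remove-∷-self u R | remove-∉ R (Unique.Unique[x∷xs]⇒x∉xs uq) = refl
  edgePairs-remove {u} w (a ∷ R) (there u∈) (a∉ ∷ uq)
    rewrite remove-∷ R (All.lookup a∉ u∈) | edgePairs-remove w R u∈ uq | sym (∑-remove (m w) R u∈ uq) =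
    solve 4 (λ a u E p → con 2 :* (a :* (E :+ u)) :+ (con 2 :* (u :* E) :+ p)
                       := con 2 :* (u :* (a :+ E)) :+ (con 2 :* (a :* E) :+ p))
      refl (m w a) (m w u) (e w (remove u R)) (edgePairs w (remove u R))

  -- In a random order of R the right-degree of u has mean e u R / 2, and each pair counted
  -- by edgePairs u R straddles u with probability 1/6.
  sixMeanAt : List (Fin n) → List (Fin n) → Fin n → ℕ
  sixMeanAt A R u = 3 * (e u A * e u R) + edgePairs u R

  sixMean : List (Fin n) → List (Fin n) → ℕ
  sixMean A R = ∑ (sixMeanAt A R) R

  ∑-edgesTo-remove : ∀ {w} R → w ∈ R → Unique R →
    ∑ (λ u → e w (remove u R)) (remove w R) + e w R ≡ length (remove w R) * e w R
  ∑-edgesTo-remove {w} R w∈ uq = begin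
    ∑ (λ u → e w (remove u R)) L + e w R
      ≡⟨ cong (∑ (λ u → e w (remove u R)) L +_) (edgesTo-remove-self R w∈ uq) ⟨
    ∑ (λ u → e w (remove u R)) L + ∑ (m w) L
      ≡⟨ ∑-distrib-+ (λ u → e w (remove u R)) (m w) L ⟨
    ∑ (λ u → e w (remove u R) + m w u) L
      ≡⟨ ∑-cong L (λ u∈ → ∑-remove (m w) R (∈-remove⁻ R u∈) uq) ⟩
    ∑ (λ _ → e w R) L
      ≡⟨ ∑-const (e w R) L ⟩
    length L * e w R ∎
    where
    open ≡-Reasoning
    L = remove w R

  ∑-mult*edgesTo-remove : ∀ {w} R → w ∈ R → Unique R →
    ∑ (λ u → m w u * e w (remove u R)) (remove w R) ≡ edgePairs w R
  ∑-mult*edgesTo-remove {w} R w∈ uq = +-cancelʳ-≡ _ _ _ (begin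
    ∑ (λ u → m w u * e w (remove u R)) L + ∑ square L
      ≡⟨ ∑-distrib-+ (λ u → m w u * e w (remove u R)) square L ⟨
    ∑ (λ u → m w u * e w (remove u R) + m w u * m w u) L
      ≡⟨ ∑-cong L (λ {u} u∈ → trans (cong (m w u *_) (sym (∑-remove (m w) R (∈-remove⁻ R u∈) uq)))
                                     (*-distribˡ-+ (m w u) _ _)) ⟨
    ∑ (λ u → m w u * e w R) L
      ≡⟨ ∑-cong L (λ {u} _ → *-comm (m w u) (e w R)) ⟩
    ∑ (λ u → e w R * m w u) L
      ≡⟨ ∑-*ˡ (e w R) (m w) L ⟩
    e w R * e w L
      ≡⟨ cong (e w R *_) (edgesTo-remove-self R w∈ uq) ⟩
    e w R * e w R
      ≡⟨ edgePairs+squares w R ⟨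
    edgePairs w R + ∑ square R
      ≡⟨ cong (edgePairs w R +_) ∑-square-remove ⟨
    edgePairs w R + ∑ square L ∎)
    where
    open ≡-Reasoning
    L = remove w R
    square : Fin n → ℕ
    square u = m w u * m w u
    ∑-square-remove : ∑ square L ≡ ∑ square R
    ∑-square-remove = begin
      ∑ square L             ≡⟨ +-identityʳ _ ⟨
      ∑ square L + 0         ≡⟨ cong (λ k → ∑ square L + k * k) (loopFree G w) ⟨
      ∑ square L + square w  ≡⟨ ∑-remove square R w∈ uq ⟩
      ∑ square R             ∎

  sixMeanAt-remove : ∀ {u} A w R → u ∈ R → Unique R →
    sixMeanAt (u ∷ A) (remove u R) w ≡ 3 * (e w A * e w (remove u R)) + (m w u * e w (remove u R) + edgePairs w R)
  sixMeanAt-remove {u} A w R u∈ uq rewrite edgePairs-remove w R u∈ uq =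
    solve 4 (λ y a x p → con 3 :* ((y :+ a) :* x) :+ p := con 3 :* (a :* x) :+ (y :* x :+ (con 2 :* (y :* x) :+ p)))
      refl (m w u) (e w A) (e w (remove u R)) (edgePairs w (remove u R))

  ∑-sixMeanAt-remove : ∀ A {w} R → w ∈ R → Unique R →
    ∑ (λ u → sixMeanAt (u ∷ A) (remove u R) w) (remove w R) + 6 * (e w A * e w R) ≡ length R * sixMeanAt A R w
  ∑-sixMeanAt-remove A {w} R w∈ uq = begin
    ∑ (λ u → sixMeanAt (u ∷ A) (remove u R) w) L + 6 * (a * E)
      ≡⟨ cong (_+ 6 * (a * E)) (∑-cong L (λ u∈ → sixMeanAt-remove A w R (∈-remove⁻ R u∈) uq)) ⟩
    ∑ (λ u → 3 * (a * x u) + (m w u * x u + P)) L + 6 * (a * E)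
      ≡⟨ cong (_+ 6 * (a * E)) ∑-split ⟩
    3 * (a * ∑ x L) + (∑ (λ u → m w u * x u) L + length L * P) + 6 * (a * E)
      ≡⟨ solve 6 (λ a X Y l p E → con 3 :* (a :* X) :+ (Y :+ l :* p) :+ con 6 :* (a :* E)
                               := con 3 :* (a :* (X :+ E)) :+ con 3 :* (a :* E) :+ Y :+ l :* p)
           refl a (∑ x L) (∑ (λ u → m w u * x u) L) (length L) P E ⟩
    3 * (a * (∑ x L + E)) + 3 * (a * E) + ∑ (λ u → m w u * x u) L + length L * P
      ≡⟨ cong₂ (λ s t → 3 * (a * s) + 3 * (a * E) + t + length L * P)
           (∑-edgesTo-remove R w∈ uq) (∑-mult*edgesTo-remove R w∈ uq) ⟩
    3 * (a * (length L * E)) + 3 * (a * E) + P + length L * P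
      ≡⟨ solve 4 (λ a l E p → con 3 :* (a :* (l :* E)) :+ con 3 :* (a :* E) :+ p :+ l :* p
                             := (con 1 :+ l) :* (con 3 :* (a :* E) :+ p)) refl a (length L) E P ⟩
    suc (length L) * sixMeanAt A R w
      ≡⟨ cong (_* sixMeanAt A R w) (length-remove R w∈ uq) ⟨
    length R * sixMeanAt A R w ∎
    where
    open ≡-Reasoning
    L = remove w R
    a = e w A
    E = e w R
    P = edgePairs w R
    x : Fin n → ℕ
    x u = e w (remove u R)
    ∑-split : ∑ (λ u → 3 * (a * x u) + (m w u * x u + P)) L
            ≡ 3 * (a * ∑ x L) + (∑ (λ u → m w u * x u) L + length L * P)
    ∑-split = trans (∑-distrib-+ _ _ L)
      (cong₂ _+_ (trans (∑-*ˡ 3 _ L) (cong (3 *_) (∑-*ˡ a x L)))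
                 (trans (∑-distrib-+ _ _ L) (cong (∑ (λ u → m w u * x u) L +_) (∑-const P L))))

  sixMean-recurrence : ∀ A R → Unique R →
    ∑ (λ u → 6 * (e u A * e u R) + sixMean (u ∷ A) (remove u R)) R ≡ length R * sixMean A R
  sixMean-recurrence A R uq = begin
    ∑ (λ u → 6 * (e u A * e u R) + sixMean (u ∷ A) (remove u R)) R
      ≡⟨ ∑-distrib-+ (λ u → 6 * (e u A * e u R)) (λ u → sixMean (u ∷ A) (remove u R)) R ⟩
    ∑ (λ u → 6 * (e u A * e u R)) R + ∑ (λ u → sixMean (u ∷ A) (remove u R)) R
      ≡⟨ +-comm (∑ (λ u → 6 * (e u A * e u R)) R) _ ⟩
    ∑ (λ u → ∑ (H u) (remove u R)) R + ∑ (λ w → 6 * (e w A * e w R)) R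
      ≡⟨ cong (_+ ∑ (λ w → 6 * (e w A * e w R)) R) (∑-remove-comm H R uq) ⟩
    ∑ (λ w → ∑ (λ u → H u w) (remove w R)) R + ∑ (λ w → 6 * (e w A * e w R)) R
      ≡⟨ ∑-distrib-+ (λ w → ∑ (λ u → H u w) (remove w R)) (λ w → 6 * (e w A * e w R)) R ⟨
    ∑ (λ w → ∑ (λ u → H u w) (remove w R) + 6 * (e w A * e w R)) R
      ≡⟨ ∑-cong R (λ w∈ → ∑-sixMeanAt-remove A R w∈ uq) ⟩
    ∑ (λ w → length R * sixMeanAt A R w) R
      ≡⟨ ∑-*ˡ (length R) (sixMeanAt A R) R ⟩
    length R * sixMean A R ∎
    where
    open ≡-Reasoning
    H : Fin n → Fin n → ℕ
    H u = sixMeanAt (u ∷ A) (remove u R)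

  ∑-scoreFrom-∷-perms : ∀ A u R →
    ∑ (scoreFrom G A ∘ (u ∷_)) (perms R) ≡ length R ! * (e u A * e u R) + ∑ (scoreFrom G (u ∷ A)) (perms R)
  ∑-scoreFrom-∷-perms A u R = begin
    ∑ (λ π → e u A * e u π + scoreFrom G (u ∷ A) π) (perms R)
      ≡⟨ ∑-distrib-+ (λ π → e u A * e u π) (scoreFrom G (u ∷ A)) (perms R) ⟩
    ∑ (λ π → e u A * e u π) (perms R) + ∑ (scoreFrom G (u ∷ A)) (perms R)
      ≡⟨ cong (_+ ∑ (scoreFrom G (u ∷ A)) (perms R)) (begin
           ∑ (λ π → e u A * e u π) (perms R)
             ≡⟨ ∑-cong (perms R) (λ π∈ → cong (e u A *_) (∑-↭ (m u) (perms-↭ R π∈))) ⟩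
           ∑ (λ _ → e u A * e u R) (perms R)   ≡⟨ ∑-const (e u A * e u R) (perms R) ⟩
           length (perms R) * (e u A * e u R)  ≡⟨ cong (_* (e u A * e u R)) (length-perms R) ⟩
           length R ! * (e u A * e u R)        ∎) ⟩
    length R ! * (e u A * e u R) + ∑ (scoreFrom G (u ∷ A)) (perms R) ∎
    where open ≡-Reasoning

  6*∑-scoreFrom-perms : ∀ k A R → length R ≡ k → Unique R → 6 * ∑ (scoreFrom G A) (perms R) ≡ k ! * sixMean A R
  6*∑-scoreFrom-perms zero A [] refl _ = refl
  6*∑-scoreFrom-perms (suc k) A R@(x ∷ xs) len uq = begin
    6 * ∑ (scoreFrom G A) (perms R)
      ≡⟨ cong (6 *_) (∑-perms-by-head R (here refl) uq (scoreFrom G A)) ⟩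
    6 * ∑ (λ u → ∑ (scoreFrom G A ∘ (u ∷_)) (perms (remove u R))) R
      ≡⟨ ∑-*ˡ 6 (λ u → ∑ (scoreFrom G A ∘ (u ∷_)) (perms (remove u R))) R ⟨
    ∑ (λ u → 6 * ∑ (scoreFrom G A ∘ (u ∷_)) (perms (remove u R))) R
      ≡⟨ ∑-cong R by-head ⟩
    ∑ (λ u → k ! * (6 * (e u A * e u R) + sixMean (u ∷ A) (remove u R))) R
      ≡⟨ ∑-*ˡ (k !) (λ u → 6 * (e u A * e u R) + sixMean (u ∷ A) (remove u R)) R ⟩
    k ! * ∑ (λ u → 6 * (e u A * e u R) + sixMean (u ∷ A) (remove u R)) R
      ≡⟨ cong (k ! *_) (sixMean-recurrence A R uq) ⟩
    k ! * (length R * sixMean A R)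
      ≡⟨ cong (λ l → k ! * (l * sixMean A R)) len ⟩
    k ! * (suc k * sixMean A R)
      ≡⟨ solve 3 (λ f s b → f :* (s :* b) := (s :* f) :* b) refl (k !) (suc k) (sixMean A R) ⟩
    suc k ! * sixMean A R ∎
    where
    open ≡-Reasoning
    by-head : ∀ {u} → u ∈ R →
      6 * ∑ (scoreFrom G A ∘ (u ∷_)) (perms (remove u R)) ≡ k ! * (6 * (e u A * e u R) + sixMean (u ∷ A) (remove u R))
    by-head {u} u∈ = begin
      6 * ∑ (scoreFrom G A ∘ (u ∷_)) (perms L)
        ≡⟨ cong (6 *_) (∑-scoreFrom-∷-perms A u L) ⟩
      6 * (length L ! * (e u A * e u L) + ∑ (scoreFrom G (u ∷ A)) (perms L))
        ≡⟨ cong₂ (λ l d → 6 * (l ! * (e u A * d) + ∑ (scoreFrom G (u ∷ A)) (perms L)))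
                 length-L (edgesTo-remove-self R u∈ uq) ⟩
      6 * (k ! * (e u A * e u R) + ∑ (scoreFrom G (u ∷ A)) (perms L))
        ≡⟨ *-distribˡ-+ 6 (k ! * (e u A * e u R)) _ ⟩
      6 * (k ! * (e u A * e u R)) + 6 * ∑ (scoreFrom G (u ∷ A)) (perms L)
        ≡⟨ cong (6 * (k ! * (e u A * e u R)) +_) (6*∑-scoreFrom-perms k (u ∷ A) L length-L (Unique-remove u uq)) ⟩
      6 * (k ! * (e u A * e u R)) + k ! * sixMean (u ∷ A) L
        ≡⟨ solve 3 (λ f a b → con 6 :* (f :* a) :+ f :* b := f :* (con 6 :* a :+ b))
                 refl (k !) (e u A * e u R) (sixMean (u ∷ A) L) ⟩
      k ! * (6 * (e u A * e u R) + sixMean (u ∷ A) L) ∎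
      where
      L = remove u R
      length-L : length L ≡ k
      length-L = suc-injective (trans (sym (length-remove R u∈ uq)) len)

  2*scoreFrom-≤ : ∀ A τ → 2 * scoreFrom G A τ ≤ ∑ (λ u → 2 * (e u A * e u τ) + edgePairs u τ) τ
  2*scoreFrom-≤ A [] = z≤n
  2*scoreFrom-≤ A (x ∷ ρ) = begin
    2 * (e x A * e x ρ + scoreFrom G (x ∷ A) ρ)
      ≡⟨ *-distribˡ-+ 2 (e x A * e x ρ) (scoreFrom G (x ∷ A) ρ) ⟩
    2 * (e x A * e x ρ) + 2 * scoreFrom G (x ∷ A) ρ
      ≤⟨ +-mono-≤ head-≤ (2*scoreFrom-≤ (x ∷ A) ρ) ⟩
    bound A (x ∷ ρ) x + ∑ (bound (x ∷ A) ρ) ρ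
      ≤⟨ +-monoʳ-≤ (bound A (x ∷ ρ) x) (∑-mono-≤ ρ (λ {u} _ → tail-≤ u)) ⟩
    bound A (x ∷ ρ) x + ∑ (bound A (x ∷ ρ)) ρ ∎
    where
    open ≤-Reasoning
    bound : List (Fin n) → List (Fin n) → Fin n → ℕ
    bound A τ u = 2 * (e u A * e u τ) + edgePairs u τ
    head-≤ : 2 * (e x A * e x ρ) ≤ bound A (x ∷ ρ) x
    head-≤ = ≤-trans (≤-reflexive (cong (λ k → 2 * (e x A * (k + e x ρ))) (sym (loopFree G x)))) (m≤m+n _ _)
    tail-≤ : ∀ u → bound (x ∷ A) ρ u ≤ bound A (x ∷ ρ) u
    tail-≤ u = ≤-trans (m≤m+n _ (2 * (e u A * m u x)))
      (≤-reflexive (solve 4 (λ mx a E p → con 2 :* ((mx :+ a) :* E) :+ p :+ con 2 :* (a :* mx)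
                                      := con 2 :* (a :* (mx :+ E)) :+ (con 2 :* (mx :* E) :+ p))
        refl (m u x) (e u A) (e u ρ) (edgePairs u ρ)))

  2*score-≤-sixMean : ∀ {τ R} → τ ↭ R → 2 * score G τ ≤ sixMean [] R
  2*score-≤-sixMean {τ} {R} τ↭R = begin
    2 * score G τ                 ≤⟨ 2*scoreFrom-≤ [] τ ⟩
    ∑ (λ u → edgePairs u τ) τ     ≡⟨ ∑-cong τ (λ {u} _ → edgePairs-↭ u τ↭R) ⟩
    ∑ (λ u → edgePairs u R) τ     ≡⟨ ∑-↭ (λ u → edgePairs u R) τ↭R ⟩
    sixMean [] R                  ∎
    where open ≤-Reasoning

  score-≤-3*mean : ∀ {τ R} → Unique R → τ ↭ R → length R ! * (2 * score G τ) ≤ 6 * ∑ (score G) (perms R)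
  score-≤-3*mean {τ} {R} uq τ↭R = begin
    length R ! * (2 * score G τ)     ≤⟨ *-monoʳ-≤ (length R !) (2*score-≤-sixMean τ↭R) ⟩
    length R ! * sixMean [] R        ≡⟨ 6*∑-scoreFrom-perms (length R) [] R refl uq ⟨
    6 * ∑ (score G) (perms R)        ∎
    where open ≤-Reasoning

+/-≤⇔ : ∀ a b c d .{{_ : NonZero b}} .{{_ : NonZero d}} → (ℤ.+ a / b ≤ℚ ℤ.+ c / d) ⇔ (a * d ≤ c * b)
+/-≤⇔ a b@(suc b-1) c d@(suc d-1) = mk⇔ to from
  where
  -- ℤ.+ a / b unfolds to fromℚᵘ p
  p = mkℚᵘ (ℤ.+ a) b-1
  q = mkℚᵘ (ℤ.+ c) d-1
  to : fromℚᵘ p ≤ℚ fromℚᵘ q → a * d ≤ c * b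
  to le with ℚᵘ.≤-respˡ-≃ (ℚ.toℚᵘ-fromℚᵘ p)
               (ℚᵘ.≤-respʳ-≃ (ℚ.toℚᵘ-fromℚᵘ q) (ℚ.toℚᵘ-mono-≤ le))
  ... | *≤* le′ = ℤ.drop‿+≤+ (subst₂ ℤ._≤_ (sym (ℤ.pos-* a d)) (sym (ℤ.pos-* c b)) le′)
  from : a * d ≤ c * b → fromℚᵘ p ≤ℚ fromℚᵘ q
  from le = ℚ.toℚᵘ-cancel-≤ (ℚᵘ.≤-respˡ-≃ (ℚᵘ.≃-sym (ℚ.toℚᵘ-fromℚᵘ p))
    (ℚᵘ.≤-respʳ-≃ (ℚᵘ.≃-sym (ℚ.toℚᵘ-fromℚᵘ q))
      (*≤* (subst₂ ℤ._≤_ (ℤ.pos-* a d) (ℤ.pos-* c b) (ℤ.+≤+ le)))))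

average≡ : ∀ xs {d} .{{_ : NonZero d}} → length xs ≡ d → average xs ≡ (ℤ.+ sum xs) / d
average≡ (x ∷ xs) refl = refl

module Greedy {n : ℕ} (G : Multigraph n) where
  open Removal (_≟_ {n})
  open DecMem (_≟_ {n}) using (_∈?_)

  remaining-∷ʳ : ∀ pre u → remaining (pre ++ [ u ]) ≡ remove u (remaining pre)
  remaining-∷ʳ pre u = trans
    (filter-≐ (λ w → ¬? (w ∈? pre ++ [ u ])) (λ w → ¬? (w ∈? pre) ×-dec ¬? (w ≟ u)) split (allFin n))
    (sym (filter-filter (λ w → ¬? (w ≟ u)) (λ w → ¬? (w ∈? pre)) (allFin n)))
    where
    split : (λ w → w ∉ pre ++ [ u ]) ≐ (λ w → w ∉ pre × w ≢ u)
    split = (λ w∉ → w∉ ∘ ∈-++⁺ˡ , w∉ ∘ ∈-++⁺ʳ pre ∘ here)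
          , (λ (w∉pre , w≢u) w∈ → [ w∉pre , (λ { (here w≡u) → w≢u w≡u }) ]′ (∈-++⁻ pre w∈))

  ∈-remaining⁺ : ∀ {pre u} → u ∉ pre → u ∈ remaining pre
  ∈-remaining⁺ {pre} {u} = ∈-filter⁺ (λ w → ¬? (w ∈? pre)) (∈-allFin u)

  ∈-remaining⁻ : ∀ {pre u} → u ∈ remaining pre → u ∉ pre
  ∈-remaining⁻ {pre} u∈ = proj₂ (∈-filter⁻ (λ w → ¬? (w ∈? pre)) {xs = allFin n} u∈)

  Unique-remaining : ∀ pre → Unique (remaining pre)
  Unique-remaining pre = Unique.filter⁺ (λ w → ¬? (w ∈? pre)) (Unique.allFin⁺ n)

  length-remaining-∷ʳ : ∀ {pre u} → u ∈ remaining pre →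
    length (remaining pre) ≡ suc (length (remaining (pre ++ [ u ])))
  length-remaining-∷ʳ {pre} {u} u∈ =
    trans (length-remove (remaining pre) u∈ (Unique-remaining pre)) (cong (suc ∘ length) (sym (remaining-∷ʳ pre u)))

  remaining-[] : remaining [] ≡ allFin n
  remaining-[] = filter-all (λ w → ¬? (w ∈? [])) {xs = allFin n} (All.tabulate (λ _ ()))

  remaining-complete : ∀ {σ} → IsOrder σ → remaining σ ≡ []
  remaining-complete {σ} σ↭ = filter-none (λ w → ¬? (w ∈? σ)) {xs = allFin n}
    (All.tabulate (λ {w} _ w∉σ → w∉σ (∈-resp-↭ (↭-sym σ↭) (∈-allFin w))))

  totalScore : List (Fin n) → ℕ
  totalScore pre = ∑ (λ τ → score G (pre ++ τ)) (perms (remaining pre))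

  completionCount : List (Fin n) → ℕ
  completionCount pre = length (remaining pre) !

  instance
    completionCount-nonZero : ∀ {pre} → NonZero (completionCount pre)
    completionCount-nonZero {pre} = length (remaining pre) !≢0

  𝔼≡ : ∀ pre → 𝔼 G pre ≡ (ℤ.+ totalScore pre) / completionCount pre
  𝔼≡ pre = average≡ (map (λ τ → score G (pre ++ τ)) (perms (remaining pre)))
    (trans (length-map _ (perms (remaining pre))) (length-perms (remaining pre)))

  𝔼-≤⇔ : ∀ p q → (𝔼 G p ≤ℚ 𝔼 G q) ⇔ (totalScore p * completionCount q ≤ totalScore q * completionCount p)
  𝔼-≤⇔ p q rewrite 𝔼≡ p | 𝔼≡ q =
    +/-≤⇔ (totalScore p) (completionCount p) (totalScore q) (completionCount q)

  totalScore-extensions : ∀ {pre v} → v ∈ remaining pre →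
    totalScore pre ≡ ∑ (λ u → totalScore (pre ++ [ u ])) (remaining pre)
  totalScore-extensions {pre} v∈ = trans
    (∑-perms-by-head (remaining pre) v∈ (Unique-remaining pre) (λ τ → score G (pre ++ τ)))
    (∑-cong (remaining pre) (λ {u} _ → begin
      ∑ (λ π → score G (pre ++ u ∷ π)) (perms (remove u (remaining pre)))
        ≡⟨ cong (λ R → ∑ (λ π → score G (pre ++ u ∷ π)) (perms R)) (remaining-∷ʳ pre u) ⟨
      ∑ (λ π → score G (pre ++ u ∷ π)) (perms (remaining (pre ++ [ u ])))
        ≡⟨ ∑-cong (perms (remaining (pre ++ [ u ]))) (λ {π} _ → cong (score G) (++-assoc pre [ u ] π)) ⟨
      totalScore (pre ++ [ u ]) ∎))
    where open ≡-Reasoning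

  greedy-step : ∀ {pre v} → v ∉ pre → (∀ u → u ∉ pre → 𝔼 G (pre ++ [ u ]) ≤ℚ 𝔼 G (pre ++ [ v ])) →
    𝔼 G pre ≤ℚ 𝔼 G (pre ++ [ v ])
  greedy-step {pre} {v} v∉ v-max = Equivalence.from (𝔼-≤⇔ pre (pre ++ [ v ])) (begin
    totalScore pre * k !       ≡⟨ cong (_* k !) (totalScore-extensions v∈) ⟩
    ∑ T R * k !                ≤⟨ *-monoˡ-≤ (k !) (∑-mono-≤ R T≤Tv) ⟩
    ∑ (λ _ → T v) R * k !      ≡⟨ cong (_* k !) (∑-const (T v) R) ⟩
    length R * T v * k !       ≡⟨ cong (λ l → l * T v * k !) length-R ⟩
    suc k * T v * k !          ≡⟨ solve 3 (λ s t f → s :* t :* f := t :* (s :* f)) refl (suc k) (T v) (k !) ⟩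
    T v * suc k !              ≡⟨ cong (λ l → T v * l !) length-R ⟨
    T v * completionCount pre  ∎)
    where
    open ≤-Reasoning
    R = remaining pre
    T : Fin n → ℕ
    T u = totalScore (pre ++ [ u ])
    k = length (remaining (pre ++ [ v ]))
    v∈ : v ∈ R
    v∈ = ∈-remaining⁺ v∉
    length-R : length R ≡ suc k
    length-R = length-remaining-∷ʳ v∈
    T≤Tv : ∀ {u} → u ∈ R → T u ≤ T v
    T≤Tv {u} u∈ = *-cancelʳ-≤ (T u) (T v) (k !) {{k !≢0}}
      (subst (λ l → T u * k ! ≤ T v * l !) same-k
        (Equivalence.to (𝔼-≤⇔ (pre ++ [ u ]) (pre ++ [ v ])) (v-max u (∈-remaining⁻ u∈))))
      where
      same-k : length (remaining (pre ++ [ u ])) ≡ k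
      same-k = suc-injective (trans (sym (length-remaining-∷ʳ u∈)) length-R)

  greedy-monotone : ∀ {σ} → IsGreedyOutput G σ → ∀ pre suf → σ ≡ pre ++ suf → 𝔼 G pre ≤ℚ 𝔼 G σ
  greedy-monotone _ pre [] refl = ℚ.≤-reflexive (cong (𝔼 G) (sym (++-identityʳ pre)))
  greedy-monotone greedy@(σ↭ , maximal) pre (v ∷ suf) refl = ℚ.≤-trans
    (greedy-step (Unique-++-∷⇒∉ pre (Unique-resp-↭ (↭-sym σ↭) (Unique.allFin⁺ n))) (maximal pre v suf refl))
    (greedy-monotone greedy (pre ++ [ v ]) suf (sym (++-assoc pre [ v ] suf)))

  greedy-≥-mean : ∀ {σ} → IsGreedyOutput G σ → ∑ (score G) (perms (allFin n)) ≤ score G σ * length (allFin n) !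
  greedy-≥-mean {σ} greedy@(σ↭ , _) = subst₂ _≤_ lhs rhs
    (Equivalence.to (𝔼-≤⇔ [] σ) (greedy-monotone greedy [] σ refl))
    where
    lhs : totalScore [] * completionCount σ ≡ ∑ (score G) (perms (allFin n))
    lhs rewrite remaining-complete σ↭ | remaining-[] = *-identityʳ _
    rhs : totalScore σ * completionCount [] ≡ score G σ * length (allFin n) !
    rhs rewrite remaining-complete σ↭ | remaining-[] | ++-identityʳ σ =
      cong (_* length (allFin n) !) (+-identityʳ (score G σ))

theorem18 : (n : ℕ) (G : Multigraph n) (σ : List (Fin n)) →
    IsGreedyOutput G σ →
    ∀ (τ : List (Fin n)) → IsOrder τ → score G τ ≤ 3 * score G σ
theorem18 n G σ greedy τ τ↭ = *-cancelˡ-≤ 2 (*-cancelˡ-≤ N {{length (allFin n) !≢0}} (begin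
  N * (2 * score G τ)                 ≤⟨ score-≤-3*mean (Unique.allFin⁺ n) τ↭ ⟩
  6 * ∑ (score G) (perms (allFin n))  ≤⟨ *-monoʳ-≤ 6 (greedy-≥-mean greedy) ⟩
  6 * (score G σ * N)                 ≡⟨ solve 2 (λ s f → con 6 :* (s :* f) := f :* (con 2 :* (con 3 :* s)))
                                               refl (score G σ) N ⟩
  N * (2 * (3 * score G σ))           ∎))
  where
  open ≤-Reasoning
  open MeanScore G using (score-≤-3*mean)
  open Greedy G using (greedy-≥-mean)
  N = length (allFin n) !
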